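{- Let $(W,S)$ be a finite Coxeter system, $K\subseteq S$ and $K'\subseteq S$ with $W_{K'}$ conjugate to $W_K$. Let $c\in C_{K'K}$ and let $c_{K'K}\in{}^{U}c^{V}$ where $U=N_{K'}W_{K'}$ and $V=N_KW_K$. Then $c_{K'K}\in C_{K'K}$.
   Context: $\mathtt{l}$ is the length function of $W$ w.r.t. $S$; $W_J$ is the parabolic subgroup generated by $J\subseteq S$; $W^J=\{w\in W:\mathtt{l}(ws)>\mathtt{l}(w)\ \forall s\in J\}$. For $J\subseteq S$, $N_J=\{w\in W: w^{ -1}W_Jw=W_J\}\cap W^J$, and $N_JW_J=\{nk: n\in N_J, k\in W_J\}$ (this is a subgroup of $W$, the normalizer of $W_J$). $C_{K'K}=\{w\in W: w^{ -1}W_{K'}w=W_K\}$. For subgroups $U,V$ of $W$ and $w\in W$, ${}^Uw^V=\{x\in UwV: \mathtt{l}(x)\le\mathtt{l}(uxv)\ \forall u\in U,\forall v\in V\}$. -}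

module Defs where

open import Level using (Level; _⊔_) renaming (suc to lsuc)
open import Algebra.Bundles using (Group)
open import Algebra.Morphism.Structures using (module GroupMorphisms)
open import Data.Nat using (ℕ; zero; suc; _≤_; _<_)
open import Data.Fin using (Fin)
open import Data.Fin.Subset using (Subset; _∈_)
open import Data.List using (List; []; _∷_; length)
open import Data.List.Relation.Unary.All using (All)
open import Data.Product using (Σ; ∃; _×_; _,_)
open import Relation.Binary.PropositionalEquality using (_≡_)
open import Relation.Nullary using (¬_)

module _ {c ℓ : Level} (G : Group c ℓ) where
  open Group G
  pow : Carrier → ℕ → Carrier
  pow x zero    = ε
  pow x (suc k) = x ∙ pow x k

  wordProd : {n : ℕ} → (Fin n → Carrier) → List (Fin n) → Carrier
  wordProd gen []      = ε
  wordProd gen (i ∷ w) = gen i ∙ wordProd gen w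

-- A finite Coxeter system (W,S): W a group (with setoid equality ≈),
-- S = {gen i | i : Fin rank}, presented by the Coxeter matrix m
-- (all entries finite since W is finite), and W finite.
record CoxeterSystem (c ℓ : Level) : Set (lsuc (c ⊔ ℓ)) where
  field
    W     : Group c ℓ
    rank  : ℕ
    gen   : Fin rank → Group.Carrier W
    m     : Fin rank → Fin rank → ℕ

  private
    open module G = Group W using (Carrier; _≈_; _∙_; ε)
    prod : List (Fin rank) → Carrier
    prod = wordProd W gen

  field
    m-diag   : ∀ i → m i i ≡ 1
    m-sym    : ∀ i j → m i j ≡ m j i
    m-off    : ∀ i j → ¬ (i ≡ j) → 2 ≤ m i j
    relation : ∀ i j → pow W (gen i ∙ gen j) (m i j) ≈ ε
    generated : ∀ w → ∃ λ (word : List (Fin rank)) → prod word ≈ w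
    universal : (H : Group c ℓ) (f : Fin rank → Group.Carrier H) →
      (∀ i j → Group._≈_ H (pow H (Group._∙_ H (f i) (f j)) (m i j)) (Group.ε H)) →
      Σ (Carrier → Group.Carrier H) λ φ →
        GroupMorphisms.IsGroupHomomorphism (Group.rawGroup W) (Group.rawGroup H) φ ×
        (∀ i → Group._≈_ H (φ (gen i)) (f i))
    finite : ∃ λ (N : ℕ) → Σ (Fin N → Carrier) λ enum → ∀ w → ∃ λ k → enum k ≈ w

module CoxeterDefs {c ℓ : Level} (C : CoxeterSystem c ℓ) where
  open CoxeterSystem C
  open Group W

  prod : List (Fin rank) → Carrier
  prod = wordProd W gen

  IsLength : Carrier → ℕ → Set (ℓ ⊔ Level.zero)
  IsLength w n =
    (∃ λ (word : List (Fin rank)) → length word ≡ n × prod word ≈ w) ×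
    (∀ (word : List (Fin rank)) → prod word ≈ w → n ≤ length word)

  _≤ℓ_ : Carrier → Carrier → Set ℓ
  x ≤ℓ y = ∀ a b → IsLength x a → IsLength y b → a ≤ b

  _<ℓ_ : Carrier → Carrier → Set ℓ
  x <ℓ y = ∀ a b → IsLength x a → IsLength y b → a < b

  InPar : Subset rank → Carrier → Set ℓ
  InPar J w = ∃ λ (word : List (Fin rank)) → All (λ i → i ∈ J) word × prod word ≈ w

  -- w ∈ C_{K'K} :  w⁻¹ W_{K'} w = W_K  (equality of subsets of W)
  InC : Subset rank → Subset rank → Carrier → Set (c ⊔ ℓ)
  InC K' K w =
    (∀ x → InPar K' x → InPar K (w ⁻¹ ∙ x ∙ w)) ×
    (∀ y → InPar K y → ∃ λ x → InPar K' x × y ≈ w ⁻¹ ∙ x ∙ w)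

  Conjugate : Subset rank → Subset rank → Set (c ⊔ ℓ)
  Conjugate K' K = ∃ λ g → InC K' K g

  InMinCoset : Subset rank → Carrier → Set ℓ
  InMinCoset J w = ∀ s → s ∈ J → w <ℓ (w ∙ gen s)

  InN : Subset rank → Carrier → Set (c ⊔ ℓ)
  InN J w = InC J J w × InMinCoset J w

  InNW : Subset rank → Carrier → Set (c ⊔ ℓ)
  InNW J w = ∃ λ n → ∃ λ k → InN J n × InPar J k × w ≈ n ∙ k

  -- x ∈ ^U c ^V  for subgroups U, V given as predicates
  InMinDouble : (Carrier → Set (c ⊔ ℓ)) → Carrier → (Carrier → Set (c ⊔ ℓ)) → Carrier → Set (c ⊔ ℓ)
  InMinDouble U w V x =
    (∃ λ u → ∃ λ v → U u × V v × x ≈ u ∙ w ∙ v) ×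
    (∀ u v → U u → V v → x ≤ℓ (u ∙ x ∙ v))

module Submission where

open import Defs
open import Level using (Level; _⊔_)
open import Algebra.Bundles using (Group)
open import Data.Fin.Subset using (Subset; _∈_)
open import Data.List using ([]; _∷_; _++_)
open import Data.List.Relation.Unary.All using (All; []; _∷_)
open import Data.List.Relation.Unary.All.Properties using (++⁺)
open import Data.Product using (∃; _×_; _,_)
open import Relation.Binary.Definitions using (_Respects_)
open import Relation.Binary.PropositionalEquality using (subst)
import Algebra.Properties.Group as GroupProperties
import Relation.Binary.Reasoning.Setoid as SetoidReasoning

module Conjugation {c ℓ : Level} (G : Group c ℓ) where
  open Group G
  open GroupProperties G
  open SetoidReasoning setoid

  conj : Carrier → Carrier → Carrier
  conj w x = w ⁻¹ ∙ x ∙ w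

  conj-cong : ∀ {w w′ x x′} → w ≈ w′ → x ≈ x′ → conj w x ≈ conj w′ x′
  conj-cong w≈w′ x≈x′ = ∙-cong (∙-cong (⁻¹-cong w≈w′) x≈x′) w≈w′

  conj-∙ : ∀ a b x → conj (a ∙ b) x ≈ conj b (conj a x)
  conj-∙ a b x = begin
    (a ∙ b) ⁻¹ ∙ x ∙ (a ∙ b)     ≈⟨ ∙-congʳ (∙-congʳ (⁻¹-anti-homo-∙ a b)) ⟩
    b ⁻¹ ∙ a ⁻¹ ∙ x ∙ (a ∙ b)    ≈⟨ ∙-congʳ (assoc _ _ _) ⟩
    b ⁻¹ ∙ (a ⁻¹ ∙ x) ∙ (a ∙ b)  ≈⟨ sym (assoc _ _ _) ⟩
    b ⁻¹ ∙ (a ⁻¹ ∙ x) ∙ a ∙ b    ≈⟨ ∙-congʳ (assoc _ _ _) ⟩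
    b ⁻¹ ∙ (a ⁻¹ ∙ x ∙ a) ∙ b    ∎

  conj-ε : ∀ x → conj ε x ≈ x
  conj-ε x = begin
    ε ⁻¹ ∙ x ∙ ε  ≈⟨ identityʳ _ ⟩
    ε ⁻¹ ∙ x      ≈⟨ ∙-congʳ ε⁻¹≈ε ⟩
    ε ∙ x         ≈⟨ identityˡ x ⟩
    x             ∎

  conj-conj-⁻¹ : ∀ a y → y ≈ conj a (conj (a ⁻¹) y)
  conj-conj-⁻¹ a y = begin
    y                       ≈⟨ conj-ε y ⟨
    conj ε y                ≈⟨ conj-cong (inverseˡ a) refl ⟨
    conj (a ⁻¹ ∙ a) y       ≈⟨ conj-∙ (a ⁻¹) a y ⟩
    conj a (conj (a ⁻¹) y)  ∎

  Transports : ∀ {p} → (Carrier → Set p) → (Carrier → Set p) → Carrier → Set (c ⊔ ℓ ⊔ p)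
  Transports A B w =
    (∀ x → A x → B (conj w x)) × (∀ y → B y → ∃ λ x → A x × y ≈ conj w x)

  record IsSubgroup {p} (A : Carrier → Set p) : Set (c ⊔ ℓ ⊔ p) where
    field
      resp-≈ : A Respects _≈_
      ∙-closed : ∀ {x y} → A x → A y → A (x ∙ y)
      ⁻¹-closed : ∀ {x} → A x → A (x ⁻¹)

  module _ {p} {A B : Carrier → Set p} where

    Transports-resp-≈ : B Respects _≈_ → ∀ {w w′} → w ≈ w′ → Transports A B w → Transports A B w′
    Transports-resp-≈ B-resp w≈w′ (forth , back) =
      (λ x Ax → B-resp (conj-cong w≈w′ refl) (forth x Ax)) ,
      (λ y By → let x , Ax , y≈ = back y By in x , Ax , trans y≈ (conj-cong w≈w′ refl))

    Transports-∙ : ∀ {D} → D Respects _≈_ → ∀ {a b} →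
                   Transports A B a → Transports B D b → Transports A D (a ∙ b)
    Transports-∙ D-resp {a} {b} (forthᵃ , backᵃ) (forthᵇ , backᵇ) =
      (λ x Ax → D-resp (sym (conj-∙ a b x)) (forthᵇ _ (forthᵃ x Ax))) ,
      (λ y Dy → let z , Bz , y≈ = backᵇ y Dy
                    x , Ax , z≈ = backᵃ z Bz
                in x , Ax , trans y≈ (trans (conj-cong refl z≈) (sym (conj-∙ a b x))))

  Transports-self : ∀ {p} {A : Carrier → Set p} → IsSubgroup A → ∀ {k} → A k → Transports A A k
  Transports-self {A = A} A-sub {k} Ak =
    (λ x Ax → conj-closed Ak Ax) ,
    (λ y Ay → conj (k ⁻¹) y , conj-closed (⁻¹-closed Ak) Ay , conj-conj-⁻¹ k y)
    where
    open IsSubgroup A-sub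
    conj-closed : ∀ {k x} → A k → A x → A (conj k x)
    conj-closed Ak Ax = ∙-closed (∙-closed (⁻¹-closed Ak) Ax) Ak

module Parabolic {c ℓ : Level} (C : CoxeterSystem c ℓ) where
  open CoxeterSystem C
  open CoxeterDefs C
  open Group W
  open GroupProperties W
  open Conjugation W
  open SetoidReasoning setoid

  prod-++ : ∀ u v → prod (u ++ v) ≈ prod u ∙ prod v
  prod-++ []      v = sym (identityˡ _)
  prod-++ (i ∷ u) v = trans (∙-congˡ (prod-++ u v)) (sym (assoc _ _ _))

  gen-⁻¹ : ∀ i → gen i ⁻¹ ≈ gen i
  gen-⁻¹ i = sym (inverseˡ-unique (gen i) (gen i) (trans (sym (identityʳ _)) sᵢ²≈ε))
    where
    sᵢ²≈ε : pow W (gen i ∙ gen i) 1 ≈ ε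
    sᵢ²≈ε = subst (λ n → pow W (gen i ∙ gen i) n ≈ ε) (m-diag i) (relation i i)

  InPar-isSubgroup : ∀ J → IsSubgroup (InPar J)
  InPar-isSubgroup J = record { resp-≈ = resp-≈ ; ∙-closed = ∙-closed ; ⁻¹-closed = ⁻¹-closed }
    where
    resp-≈ : InPar J Respects _≈_
    resp-≈ x≈y (w , w∈J , w≈x) = w , w∈J , trans w≈x x≈y

    ∙-closed : ∀ {x y} → InPar J x → InPar J y → InPar J (x ∙ y)
    ∙-closed (u , u∈J , u≈x) (v , v∈J , v≈y) =
      u ++ v , ++⁺ u∈J v∈J , trans (prod-++ u v) (∙-cong u≈x v≈y)

    word⁻¹ : ∀ w → All (_∈ J) w → InPar J (prod w ⁻¹)
    word⁻¹ []      []          = [] , [] , sym ε⁻¹≈ε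
    word⁻¹ (i ∷ w) (i∈J ∷ w∈J) =
      resp-≈ w⁻¹sᵢ≈[sᵢw]⁻¹ (∙-closed (word⁻¹ w w∈J) (i ∷ [] , i∈J ∷ [] , identityʳ _))
      where
      w⁻¹sᵢ≈[sᵢw]⁻¹ : prod w ⁻¹ ∙ gen i ≈ (gen i ∙ prod w) ⁻¹
      w⁻¹sᵢ≈[sᵢw]⁻¹ = begin
        prod w ⁻¹ ∙ gen i      ≈⟨ ∙-congˡ (gen-⁻¹ i) ⟨
        prod w ⁻¹ ∙ gen i ⁻¹   ≈⟨ ⁻¹-anti-homo-∙ (gen i) (prod w) ⟨
        (gen i ∙ prod w) ⁻¹    ∎

    ⁻¹-closed : ∀ {x} → InPar J x → InPar J (x ⁻¹)
    ⁻¹-closed (w , w∈J , w≈x) = resp-≈ (⁻¹-cong w≈x) (word⁻¹ w w∈J)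

  InC-∙ : ∀ {A B D a b} → InC A B a → InC B D b → InC A D (a ∙ b)
  InC-∙ {A} {B} {D} = Transports-∙ {A = InPar A} {InPar B} (IsSubgroup.resp-≈ (InPar-isSubgroup D))

  InC-resp-≈ : ∀ {A B a a′} → a ≈ a′ → InC A B a → InC A B a′
  InC-resp-≈ {A} {B} = Transports-resp-≈ {A = InPar A} (IsSubgroup.resp-≈ (InPar-isSubgroup B))

  InNW⇒InC : ∀ {J u} → InNW J u → InC J J u
  InNW⇒InC {J} (n , k , (n∈C , _) , k∈W_J , u≈nk) =
    InC-resp-≈ (sym u≈nk) (InC-∙ n∈C (Transports-self (InPar-isSubgroup J) k∈W_J))

lemma2p2 : {c ℓ : Level} (C : CoxeterSystem c ℓ) →
    let open CoxeterSystem C in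
    let open CoxeterDefs C in
    (K K' : Subset rank) → Conjugate K' K →
    (x : Group.Carrier W) → InC K' K x →
    (cKK : Group.Carrier W) → InMinDouble (InNW K') x (InNW K) cKK →
    InC K' K cKK
lemma2p2 C K K' _ x x∈C cKK ((u , v , u∈U , v∈V , cKK≈uxv) , _) =
  InC-resp-≈ (sym cKK≈uxv) (InC-∙ (InC-∙ (InNW⇒InC u∈U) x∈C) (InNW⇒InC v∈V))
  where
  open Parabolic C
  open Group (CoxeterSystem.W C) using (sym)
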